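{- There exist infinitely many even integers $n\ge 4$ for which the Goldbach factorization graph $F_n$ contains a Goldbach autonomous component.
   Context: For an even integer $n\ge 4$, the Goldbach factorization graph is the directed weighted graph $F_n=(V_n,A_n,w_n)$ with vertex set $V_n=[2,n-2]\cap\mathbb{P}$ ($\mathbb{P}$ the set of primes), arc set $A_n=\{(s,t)\in V_n^2 : s \mid (n-t)\}$ (loops allowed), and weights $w_n((s,t))=\max\{e\ge 1: s^e\mid (n-t)\}$. An autonomous component of $F_n$ is a minimal (with respect to inclusion) nonempty subgraph of $F_n$ induced by a vertex set $U\subseteq V_n$ such that $(s,t)\notin A_n$ for every $s\in V_n\setminus U$ and $t\in U$. A Goldbach autonomous component (GAC) is an autonomous component induced by vertices $v_1,v_2\in V_n$ with $v_1+v_2=n$ (a single vertex if $v_1=v_2$, two vertices otherwise). -}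

module Defs where

open import Level using (0ℓ)
open import Data.Nat using (ℕ; _+_; _∸_; _≤_; _*_)
open import Data.Nat.Divisibility using (_∣_)
open import Data.Nat.Primality using (Prime)
open import Data.Product using (_×_; ∃; ∃-syntax; Σ-syntax)
open import Data.Sum using (_⊎_)
open import Relation.Binary.PropositionalEquality using (_≡_)
open import Relation.Nullary using (¬_)

Vertex : ℕ → ℕ → Set
Vertex n p = Prime p × 2 ≤ p × p ≤ n ∸ 2

-- Arc set A_n: (s,t) with s,t ∈ V_n and s ∣ (n - t).
-- (For t ∈ V_n we have t ≤ n - 2, so truncated subtraction is exact.)
Arc : ℕ → ℕ → ℕ → Set
Arc n s t = Vertex n s × Vertex n t × s ∣ (n ∸ t)

Closed : (n : ℕ) → (ℕ → Set) → Set
Closed n U = ∀ s t → Vertex n s → ¬ U s → U t → ¬ Arc n s t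

Nonempty : (ℕ → Set) → Set
Nonempty U = ∃[ x ] U x

_⊆_ : (ℕ → Set) → (ℕ → Set) → Set
U ⊆ W = ∀ x → U x → W x

-- Autonomous component: the subgraph induced by a nonempty vertex set U ⊆ V_n
-- with no arcs entering it from outside, minimal w.r.t. inclusion among such sets.
-- (Induced subgraphs are determined by their vertex sets, so minimality
-- of subgraphs is minimality of vertex sets.)
IsAutonomousComponent : (n : ℕ) → (ℕ → Set) → Set₁
IsAutonomousComponent n U =
  (∀ x → U x → Vertex n x) ×
  Nonempty U ×
  Closed n U ×
  (∀ (W : ℕ → Set) → (∀ x → W x → Vertex n x) → Nonempty W → Closed n W →
     W ⊆ U → U ⊆ W)

Pair : ℕ → ℕ → ℕ → Set
Pair v₁ v₂ x = x ≡ v₁ ⊎ x ≡ v₂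

HasGAC : ℕ → Set₁
HasGAC n = ∃[ v₁ ] ∃[ v₂ ] (Vertex n v₁ × Vertex n v₂ × v₁ + v₂ ≡ n ×
             IsAutonomousComponent n (Pair v₁ v₂))

{-# OPTIONS --safe #-}
-- For a prime p, take n = 2p and the Goldbach pair (p, p).  An arc (s, p) of
-- F_2p means s ∣ 2p − p = p, so s = p: the singleton {p} has no incoming arcs
-- from outside and, being a singleton, is minimal.  Euclid's argument (a prime
-- factor of m! + 1 exceeds m) supplies arbitrarily large such n.
module Submission where

open import Defs
open import Data.Nat using (ℕ; _*_; _≤_)
open import Data.Product using (_×_; ∃-syntax)
open import Data.Nat.Base using (suc; _+_; _∸_; _<_; _!; s≤s; nonTrivial⇒n>1)
open import Data.Nat.Properties
open import Data.Nat.Divisibility using (_∣_; ∣-trans; m∣m*n; m≤n⇒m!∣n!; ∣1⇒≡1; ∣m+n∣m⇒∣n)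
open import Data.Nat.Primality using (Prime; prime; ¬prime[1]; prime⇒irreducible)
open import Data.Nat.Primality.Factorisation using (factorise)
open import Data.List.Base using ([]; _∷_)
open import Data.List.Relation.Unary.All using (_∷_)
open import Data.Product using (_,_)
open import Data.Sum using (inj₁; inj₂)
open import Relation.Binary.PropositionalEquality using (_≡_; refl; sym; cong; subst)
open import Relation.Nullary using (contradiction; yes; no)

prime⇒2≤ : ∀ {p} → Prime p → 2 ≤ p
prime⇒2≤ {p} (prime _) = nonTrivial⇒n>1 p

prime∣prime⇒≡ : ∀ {s p} → Prime s → Prime p → s ∣ p → s ≡ p
prime∣prime⇒≡ ps pp s∣p with prime⇒irreducible pp s∣p
... | inj₁ s≡1 = contradiction (subst Prime s≡1 ps) ¬prime[1]
... | inj₂ s≡p = s≡p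

1+m∣n! : ∀ {m n} → suc m ≤ n → suc m ∣ n !
1+m∣n! {m} m<n = ∣-trans (m∣m*n (m !)) (m≤n⇒m!∣n! m<n)

∃prime∣ : ∀ n → 1 < n → ∃[ p ] (Prime p × p ∣ n)
∃prime∣ n@(suc _) 1<n with factorise n
... | record { factors = [] ; isFactorisation = n≡1 } = contradiction n≡1 (>⇒≢ 1<n)
... | record { factors = p ∷ ps ; isFactorisation = n≡Π ; factorsPrime = pp ∷ _ } =
  p , pp , subst (p ∣_) (sym n≡Π) (m∣m*n _)

prime∣1+m!⇒m< : ∀ {p m} → Prime p → p ∣ suc (m !) → m < p
prime∣1+m!⇒m< {suc q} {m} pp p∣1+m! with m <? suc q
... | yes m<p = m<p
... | no m≮p = contradiction (subst Prime (∣1⇒≡1 p∣1) pp) ¬prime[1]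
  where
  p∣1 : suc q ∣ 1
  p∣1 = ∣m+n∣m⇒∣n (subst (suc q ∣_) (+-comm 1 (m !)) p∣1+m!) (1+m∣n! (≮⇒≥ m≮p))

∃prime> : ∀ m → ∃[ p ] (Prime p × m < p)
∃prime> m with ∃prime∣ (suc (m !)) (s≤s (1≤n! m))
... | p , pp , p∣1+m! = p , pp , prime∣1+m!⇒m< pp p∣1+m!

2*p∸p≡p : ∀ p → 2 * p ∸ p ≡ p
2*p∸p≡p p = subst (λ x → p + x ∸ p ≡ p) (sym (+-identityʳ p)) (m+n∸m≡n p p)

p≤2*p∸2 : ∀ {p} → 2 ≤ p → p ≤ 2 * p ∸ 2
p≤2*p∸2 {p} 2≤p = begin
  p                ≤⟨ m≤m+n p (p ∸ 2) ⟩
  p + (p ∸ 2)      ≡⟨ +-∸-assoc p 2≤p ⟨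
  p + p ∸ 2        ≡⟨ cong (λ x → p + x ∸ 2) (+-identityʳ p) ⟨
  2 * p ∸ 2        ∎
  where open ≤-Reasoning

prime⇒vertex[2*p] : ∀ {p} → Prime p → Vertex (2 * p) p
prime⇒vertex[2*p] pp = pp , prime⇒2≤ pp , p≤2*p∸2 (prime⇒2≤ pp)

arc-into-p[2*p]⇒≡p : ∀ {s p} → Prime p → Arc (2 * p) s p → s ≡ p
arc-into-p[2*p]⇒≡p {p = p} pp ((ps , _) , _ , s∣2p∸p) =
  prime∣prime⇒≡ ps pp (subst (_ ∣_) (2*p∸p≡p p) s∣2p∸p)

singleton-minimal : ∀ {v} (W : ℕ → Set) → Nonempty W → W ⊆ Pair v v → Pair v v ⊆ W
singleton-minimal W (y , Wy) W⊆v x x∈v with W⊆v y Wy | x∈v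
... | inj₁ refl | inj₁ refl = Wy
... | inj₁ refl | inj₂ refl = Wy
... | inj₂ refl | inj₁ refl = Wy
... | inj₂ refl | inj₂ refl = Wy

hasGAC[2*p] : ∀ {p} → Prime p → HasGAC (2 * p)
hasGAC[2*p] {p} pp = p , p , vertex , vertex , cong (p +_) (sym (+-identityʳ p)) ,
  pair⊆V , (p , inj₁ refl) , closed , λ W _ W-nonempty _ → singleton-minimal W W-nonempty
  where
  vertex : Vertex (2 * p) p
  vertex = prime⇒vertex[2*p] pp

  pair⊆V : ∀ x → Pair p p x → Vertex (2 * p) x
  pair⊆V _ (inj₁ refl) = vertex
  pair⊆V _ (inj₂ refl) = vertex

  closed : Closed (2 * p) (Pair p p)
  closed s _ _ s∉U (inj₁ refl) arc = s∉U (inj₁ (arc-into-p[2*p]⇒≡p pp arc))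
  closed s _ _ s∉U (inj₂ refl) arc = s∉U (inj₁ (arc-into-p[2*p]⇒≡p pp arc))

proposition2 : ∀ (m : ℕ) → ∃[ k ] (m ≤ 2 * k × 4 ≤ 2 * k × HasGAC (2 * k))
proposition2 m with ∃prime> m
... | p , pp , m<p = p , ≤-trans (<⇒≤ m<p) (m≤n*m p 2) , *-monoʳ-≤ 2 (prime⇒2≤ pp) , hasGAC[2*p] pp
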